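{- Let $\tau\in\{12,\ 1\mbox{ - }2,\ 21,\ 2\mbox{ - }1\}$. For every $k\geq 2$, $$F_{\tau\mbox{ - }3\mbox{ - }4\mbox{ - }\cdots\mbox{ - }k}(x)=R_k(x),$$ where for $k=2$ the pattern is $\tau$ itself.
   Context: A generalized pattern is a permutation of $\{1,\dots,k\}$ written as a word $\tau_1\tau_2\cdots\tau_k$ in which each pair of adjacent letters may or may not be separated by a dash "-". A permutation $\pi=\pi_1\cdots\pi_n\in S_n$ contains $\tau$ if there are indices $i_1<\dots<i_k$ such that $(\pi_{i_1},\dots,\pi_{i_k})$ is order-isomorphic to $(\tau_1,\dots,\tau_k)$ and $i_{j+1}=i_j+1$ whenever $\tau_j$ and $\tau_{j+1}$ are not separated by a dash; otherwise $\pi$ avoids $\tau$. Thus $1\mbox{ - }3\mbox{ - }2$ is the classical pattern $132$. For a generalized pattern $\tau$, $F_\tau(x)=\sum_{n\geq0}f_\tau(n)x^n$, where $f_\tau(n)$ is the number of permutations in $S_n$ ($S_0$ consists of the empty permutation) avoiding both $1\mbox{ - }3\mbox{ - }2$ and $\tau$. $U_p$ is the Chebyshev polynomial of the second kind, $U_p(\cos\theta)=\sin((p+1)\theta)/\sin\theta$, and $R_p(x)=\dfrac{U_{p-1}\left(\frac{1}{2\sqrt{x}}\right)}{\sqrt{x}\,U_p\left(\frac{1}{2\sqrt{x}}\right)}$. -}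

module Defs where

open import Data.Nat using (ℕ; zero; suc; _∸_)
open import Data.Bool using (Bool; true; false)
open import Data.Fin using (Fin; toℕ) renaming (_<_ to _<ᶠ_)
import Data.Fin as F
open import Data.Vec using (Vec; lookup)
open import Data.List using (List; []; _∷_; length; map; upTo)
open import Data.List.Membership.Propositional using (_∈_)
open import Data.List.Relation.Unary.Unique.Propositional using (Unique)
open import Data.Integer using (ℤ; +_; _-_; _*_; _+_)
open import Data.Product using (Σ; _×_)
open import Relation.Nullary using (¬_)
open import Relation.Binary.PropositionalEquality using (_≡_)
open import Function.Bundles using (_⇔_)
import Data.Nat as N

-- Permutations of length n: words π₀…π_{n-1} over {0,…,n-1} (values
-- shifted down by one; irrelevant for order-isomorphism) with
-- injective (hence bijective) letter map.

Word : ℕ → Set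
Word n = Vec (Fin n) n

IsPerm : ∀ {n} → Word n → Set
IsPerm {n} π = ∀ (i j : Fin n) → lookup π i ≡ lookup π j → i ≡ j

-- Generalized patterns.
-- len    : the length k of the pattern
-- letter : the letters τ₁…τ_k (a permutation of {1,…,k})
-- dash a : whether a dash separates τ_a and τ_{a+1}
--          (value at the last position is irrelevant)

record GPattern : Set where
  field
    len    : ℕ
    letter : Fin len → ℕ
    dash   : Fin len → Bool
open GPattern public

Contains : ∀ {n} → Word n → GPattern → Set
Contains {n} π τ =
  Σ (Fin (len τ) → Fin n) λ ι →
    (∀ a b → a <ᶠ b → ι a <ᶠ ι b) ×
    (∀ a b → (letter τ a N.< letter τ b) ⇔ (lookup π (ι a) <ᶠ lookup π (ι b))) ×
    (∀ a b → toℕ b ≡ suc (toℕ a) → dash τ a ≡ false →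
       toℕ (ι b) ≡ suc (toℕ (ι a)))

Avoids : ∀ {n} → Word n → GPattern → Set
Avoids π τ = ¬ Contains π τ

p1-3-2 : GPattern
p1-3-2 = record { len = 3 ; letter = l ; dash = λ _ → true }
  where
  l : Fin 3 → ℕ
  l F.zero = 1
  l (F.suc F.zero) = 3
  l (F.suc (F.suc _)) = 2

data Tau : Set where
  t12 t1-2 t21 t2-1 : Tau

first second : Tau → ℕ
first t12 = 1
first t1-2 = 1
first t21 = 2
first t2-1 = 2
second t12 = 2
second t1-2 = 2
second t21 = 1
second t2-1 = 1

hasDash : Tau → Bool
hasDash t12 = false
hasDash t1-2 = true
hasDash t21 = false
hasDash t2-1 = true

-- the pattern τ-3-4-…-(m+2)  (for m = 0 this is τ itself)
extPattern : Tau → ℕ → GPattern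
extPattern t m = record { len = suc (suc m) ; letter = l ; dash = d }
  where
  l : Fin (suc (suc m)) → ℕ
  l F.zero = first t
  l (F.suc F.zero) = second t
  l (F.suc (F.suc j)) = 3 N.+ toℕ j
  d : Fin (suc (suc m)) → Bool
  d F.zero = hasDash t
  d (F.suc _) = true

CountIs : GPattern → ℕ → ℕ → Set
CountIs τ n c =
  Σ (List (Word n)) λ L →
    Unique L ×
    (∀ π → (π ∈ L) ⇔ (IsPerm π × Avoids π p1-3-2 × Avoids π τ)) ×
    length L ≡ c

-- With t = 1/(2√x),
--   V p (x) := x^{p/2} U_p(1/(2√x))
-- is a polynomial in x; from U_0 = 1, U_1 = 2t, U_{p+2} = 2t U_{p+1} - U_p
-- one gets V 0 = 1, V 1 = 1, V (p+2) = V (p+1) - x · V p.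
-- V p j is the coefficient of x^j in V p.  Then
--   R_p(x) = U_{p-1}(t) / (√x U_p(t)) = V (p-1) / V p.

V : ℕ → ℕ → ℤ
V zero zero = + 1
V zero (suc j) = + 0
V (suc zero) zero = + 1
V (suc zero) (suc j) = + 0
V (suc (suc p)) zero = V (suc p) zero
V (suc (suc p)) (suc j) = V (suc p) (suc j) - V p j

sumℤ : List ℤ → ℤ
sumℤ [] = + 0
sumℤ (x ∷ xs) = x + sumℤ xs

convV : (ℕ → ℕ) → ℕ → ℕ → ℤ
convV f p n = sumℤ (map (λ j → (+ f (n ∸ j)) * V p j) (upTo (suc n)))

-- A permutation π of length n + 1 avoiding 1-3-2, with its maximum n at position i, has the form
-- π = (α + j) n β with i + j = n: an entry left of n below an entry right of n would form 1-3-2.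
-- An ascent of π therefore never straddles n. Both 1-3-2 and τ-3-…-k have an ascent from their
-- first to their last letter, so an occurrence in π lies in (α + j) n or in β; dropping its last
-- letter, one in (α + j) n gives τ-3-…-(k-1) in α, and conversely such an occurrence in α extends
-- by n. Hence π avoids τ-3-…-k iff α avoids τ-3-…-(k-1) and β avoids τ-3-…-k, that is
-- F_k = 1 + x F_{k-1} F_k. Also F_2 = 1 / (1 - x), the only avoider of length n being the decreasing
-- (for 12, 1-2) or the increasing (for 21, 2-1) permutation, so F_1 = 1 fits the same recursion.
-- With V_p = x^{p/2} U_p(1/(2√x)), so that R_k = V_{k-1} / V_k and V_{p+2} = V_{p+1} - x V_p,
-- induction on k gives V_{k+1} F_{k+1} = (V_k - x V_k F_k) F_{k+1} = V_k.

module Submission where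

open import Defs
open import Data.Nat using (ℕ; suc)
open import Relation.Binary.PropositionalEquality using (_≡_)

module PowerSeries where

  open import Data.Nat.Base using (zero; _∸_)
  open import Data.Integer.Base using (ℤ; +_; _+_; _-_; _*_)
  import Data.Integer.Properties as ℤ
  open import Data.Integer.Tactic.RingSolver using (solve-∀)
  open import Data.List.Base using (map; applyUpTo)
  open import Function.Base using (_∘_; id)
  open import Relation.Binary.PropositionalEquality
  open ≡-Reasoning

  sumUpTo : ℕ → (ℕ → ℤ) → ℤ
  sumUpTo zero    g = g 0
  sumUpTo (suc n) g = g 0 + sumUpTo n (g ∘ suc)

  sumUpTo-cong : ∀ n {g h : ℕ → ℤ} → (∀ j → g j ≡ h j) → sumUpTo n g ≡ sumUpTo n h
  sumUpTo-cong zero    g≗h = g≗h 0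
  sumUpTo-cong (suc n) g≗h = cong₂ _+_ (g≗h 0) (sumUpTo-cong n (g≗h ∘ suc))

  sumUpTo-+ : ∀ n (g h : ℕ → ℤ) → sumUpTo n (λ j → g j + h j) ≡ sumUpTo n g + sumUpTo n h
  sumUpTo-+ zero    g h = refl
  sumUpTo-+ (suc n) g h = begin
    g 0 + h 0 + sumUpTo n (λ j → g (suc j) + h (suc j))
      ≡⟨ cong (_+_ (g 0 + h 0)) (sumUpTo-+ n (g ∘ suc) (h ∘ suc)) ⟩
    g 0 + h 0 + (sumUpTo n (g ∘ suc) + sumUpTo n (h ∘ suc))
      ≡⟨ interchange (g 0) (h 0) _ _ ⟩
    g 0 + sumUpTo n (g ∘ suc) + (h 0 + sumUpTo n (h ∘ suc))
      ∎
    where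
    interchange : ∀ x y u v → x + y + (u + v) ≡ x + u + (y + v)
    interchange = solve-∀

  sumUpTo-- : ∀ n (g h : ℕ → ℤ) → sumUpTo n (λ j → g j - h j) ≡ sumUpTo n g - sumUpTo n h
  sumUpTo-- zero    g h = refl
  sumUpTo-- (suc n) g h = begin
    g 0 - h 0 + sumUpTo n (λ j → g (suc j) - h (suc j))
      ≡⟨ cong (_+_ (g 0 - h 0)) (sumUpTo-- n (g ∘ suc) (h ∘ suc)) ⟩
    g 0 - h 0 + (sumUpTo n (g ∘ suc) - sumUpTo n (h ∘ suc))
      ≡⟨ interchange (g 0) (h 0) _ _ ⟩
    g 0 + sumUpTo n (g ∘ suc) - (h 0 + sumUpTo n (h ∘ suc))
      ∎
    where
    interchange : ∀ x y u v → x - y + (u - v) ≡ x + u - (y + v)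
    interchange = solve-∀

  sumUpTo-*ˡ : ∀ n r (g : ℕ → ℤ) → sumUpTo n (λ j → r * g j) ≡ r * sumUpTo n g
  sumUpTo-*ˡ zero    r g = refl
  sumUpTo-*ˡ (suc n) r g = begin
    r * g 0 + sumUpTo n (λ j → r * g (suc j)) ≡⟨ cong (_+_ (r * g 0)) (sumUpTo-*ˡ n r (g ∘ suc)) ⟩
    r * g 0 + r * sumUpTo n (g ∘ suc)          ≡⟨ ℤ.*-distribˡ-+ r (g 0) _ ⟨
    r * (g 0 + sumUpTo n (g ∘ suc))            ∎

  sumUpTo-zero : ∀ n → sumUpTo n (λ _ → + 0) ≡ + 0
  sumUpTo-zero zero    = refl
  sumUpTo-zero (suc n) = trans (ℤ.+-identityˡ _) (sumUpTo-zero n)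

  Series : Set
  Series = ℕ → ℤ

  infixl 6 _⊕_ _⊖_
  infixl 7 _⊛_
  infixr 8 x·_

  _⊕_ _⊖_ _⊛_ : Series → Series → Series
  (a ⊕ b) n = a n + b n
  (a ⊖ b) n = a n - b n
  (a ⊛ b) n = sumUpTo n (λ j → a j * b (n ∸ j))

  x·_ : Series → Series
  (x· a) zero    = + 0
  (x· a) (suc n) = a n

  𝟙 : Series
  𝟙 zero    = + 1
  𝟙 (suc n) = + 0

  ⊛-congˡ : ∀ {a a′} b → a ≗ a′ → a ⊛ b ≗ a′ ⊛ b
  ⊛-congˡ b a≗a′ n = sumUpTo-cong n (λ j → cong (_* b (n ∸ j)) (a≗a′ j))

  ⊛-congʳ : ∀ a {b b′} → b ≗ b′ → a ⊛ b ≗ a ⊛ b′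
  ⊛-congʳ a b≗b′ n = sumUpTo-cong n (λ j → cong (a j *_) (b≗b′ (n ∸ j)))

  ⊛-distribʳ-⊕ : ∀ a b c → (a ⊕ b) ⊛ c ≗ a ⊛ c ⊕ b ⊛ c
  ⊛-distribʳ-⊕ a b c n =
    trans (sumUpTo-cong n (λ j → ℤ.*-distribʳ-+ (c (n ∸ j)) (a j) (b j))) (sumUpTo-+ n _ _)

  ⊛-distribʳ-⊖ : ∀ a b c → (a ⊖ b) ⊛ c ≗ a ⊛ c ⊖ b ⊛ c
  ⊛-distribʳ-⊖ a b c n = trans (sumUpTo-cong n (λ j → distrib (a j) (b j) (c (n ∸ j)))) (sumUpTo-- n _ _)
    where
    distrib : ∀ x y z → (x - y) * z ≡ x * z - y * z
    distrib = solve-∀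

  ⊛-distribˡ-⊖ : ∀ a b c → a ⊛ (b ⊖ c) ≗ a ⊛ b ⊖ a ⊛ c
  ⊛-distribˡ-⊖ a b c n = trans (sumUpTo-cong n (λ j → distrib (a j) (b (n ∸ j)) (c (n ∸ j)))) (sumUpTo-- n _ _)
    where
    distrib : ∀ x y z → x * (y - z) ≡ x * y - x * z
    distrib = solve-∀

  x·-⊛ : ∀ a b → (x· a) ⊛ b ≗ x· (a ⊛ b)
  x·-⊛ a b zero    = refl
  x·-⊛ a b (suc n) = ℤ.+-identityˡ _

  ⊛-x· : ∀ a b → a ⊛ (x· b) ≗ x· (a ⊛ b)
  ⊛-x· a b zero          = ℤ.*-zeroʳ (a 0)
  ⊛-x· a b (suc zero)    = trans (cong (_+_ (a 0 * b 0)) (ℤ.*-zeroʳ (a 1))) (ℤ.+-identityʳ _)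
  ⊛-x· a b (suc (suc n)) = cong (_+_ (a 0 * b (suc n))) (⊛-x· (a ∘ suc) b (suc n))

  𝟙-⊛ : ∀ b → 𝟙 ⊛ b ≗ b
  𝟙-⊛ b zero    = ℤ.*-identityˡ (b 0)
  𝟙-⊛ b (suc n) = begin
    + 1 * b (suc n) + sumUpTo n (λ j → + 0 * b (n ∸ j)) ≡⟨ cong (_+_ (+ 1 * b (suc n))) (sumUpTo-zero n) ⟩
    + 1 * b (suc n) + + 0                               ≡⟨ ℤ.+-identityʳ _ ⟩
    + 1 * b (suc n)                                     ≡⟨ ℤ.*-identityˡ _ ⟩
    b (suc n)                                           ∎

  ⊛-𝟙 : ∀ a → a ⊛ 𝟙 ≗ a
  ⊛-𝟙 a zero    = ℤ.*-identityʳ (a 0)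
  ⊛-𝟙 a (suc n) = trans (cong (λ u → u + ((a ∘ suc) ⊛ 𝟙) n) (ℤ.*-zeroʳ (a 0)))
                    (trans (ℤ.+-identityˡ _) (⊛-𝟙 (a ∘ suc) n))

  ⊛-assoc : ∀ a b c → (a ⊛ b) ⊛ c ≗ a ⊛ (b ⊛ c)
  ⊛-assoc a b c zero    = ℤ.*-assoc (a 0) (b 0) (c 0)
  ⊛-assoc a b c (suc n) = begin
    (a ⊛ b) 0 * c (suc n) + ((λ j → a 0 * b (suc j) + ((a ∘ suc) ⊛ b) j) ⊛ c) n
      ≡⟨ cong (_+_ ((a ⊛ b) 0 * c (suc n))) (⊛-distribʳ-⊕ (λ j → a 0 * b (suc j)) ((a ∘ suc) ⊛ b) c n) ⟩
    (a ⊛ b) 0 * c (suc n) + (sumUpTo n (λ j → a 0 * b (suc j) * c (n ∸ j)) + ((a ∘ suc) ⊛ b ⊛ c) n)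
      ≡⟨ cong₂ (λ u v → (a ⊛ b) 0 * c (suc n) + (u + v))
           (trans (sumUpTo-cong n (λ j → ℤ.*-assoc (a 0) _ _)) (sumUpTo-*ˡ n (a 0) _))
           (⊛-assoc (a ∘ suc) b c n) ⟩
    a 0 * b 0 * c (suc n) + (a 0 * ((b ∘ suc) ⊛ c) n + ((a ∘ suc) ⊛ (b ⊛ c)) n)
      ≡⟨ regroup (a 0) (b 0) (c (suc n)) _ _ ⟩
    a 0 * (b 0 * c (suc n) + ((b ∘ suc) ⊛ c) n) + ((a ∘ suc) ⊛ (b ⊛ c)) n
      ∎
    where
    regroup : ∀ x y z u v → x * y * z + (x * u + v) ≡ x * (y * z + u) + v
    regroup = solve-∀

  x·-cong : ∀ {a b} → a ≗ b → x· a ≗ x· b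
  x·-cong a≗b zero    = refl
  x·-cong a≗b (suc n) = a≗b n

  -- (A − x B) H = A (1 − x G) H = A, once A G = B and H = 1 / (1 − x G).
  fixpoint-cancel : ∀ {A B G H : Series} → H ≗ 𝟙 ⊕ x· (G ⊛ H) → A ⊛ G ≗ B → (A ⊖ x· B) ⊛ H ≗ A
  fixpoint-cancel {A} {B} {G} {H} H-fix AG≗B n = begin
    ((A ⊖ x· B) ⊛ H) n                  ≡⟨ ⊛-distribʳ-⊖ A (x· B) H n ⟩
    (A ⊛ H) n - (x· B ⊛ H) n            ≡⟨ cong ((A ⊛ H) n -_) (x·-⊛ B H n) ⟩
    (A ⊛ H) n - (x· (B ⊛ H)) n          ≡⟨ cong ((A ⊛ H) n -_) (x·-cong ABH n) ⟩
    (A ⊛ H) n - (x· (A ⊛ (G ⊛ H))) n    ≡⟨ cong ((A ⊛ H) n -_) (⊛-x· A (G ⊛ H) n) ⟨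
    (A ⊛ H) n - (A ⊛ x· (G ⊛ H)) n      ≡⟨ ⊛-distribˡ-⊖ A H (x· (G ⊛ H)) n ⟨
    (A ⊛ (H ⊖ x· (G ⊛ H))) n            ≡⟨ ⊛-congʳ A H-unfix n ⟩
    (A ⊛ 𝟙) n                           ≡⟨ ⊛-𝟙 A n ⟩
    A n                                 ∎
    where
    ABH : B ⊛ H ≗ A ⊛ (G ⊛ H)
    ABH k = trans (⊛-congˡ H (sym ∘ AG≗B) k) (⊛-assoc A G H k)
    cancel : ∀ x y → x + y - y ≡ x
    cancel = solve-∀
    H-unfix : H ⊖ x· (G ⊛ H) ≗ 𝟙
    H-unfix k = trans (cong (_- (x· (G ⊛ H)) k) (H-fix k)) (cancel (𝟙 k) _)

  V-rec : ∀ p → V (suc (suc p)) ≗ V (suc p) ⊖ x· V p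
  V-rec p zero    = sym (ℤ.+-identityʳ (V (suc p) 0))
  V-rec p (suc j) = refl

  V₁≗V₀ : V 1 ≗ V 0
  V₁≗V₀ zero    = refl
  V₁≗V₀ (suc j) = refl

  -- G m plays the role of R_{m+1}: G 0 = R_1 = 1, and R_{k+1} = 1 / (1 − x R_k).
  V-ratio : (G : ℕ → Series) → G 0 ≗ 𝟙 → (∀ m → G (suc m) ≗ 𝟙 ⊕ x· (G m ⊛ G (suc m))) →
            ∀ m → V (suc m) ⊛ G m ≗ V m
  V-ratio G G₀ G-rec zero    n = trans (⊛-congʳ (V 1) G₀ n) (trans (⊛-𝟙 (V 1) n) (V₁≗V₀ n))
  V-ratio G G₀ G-rec (suc m) n =
    trans (⊛-congˡ (G (suc m)) (V-rec m) n)
          (fixpoint-cancel {V (suc m)} {V m} {G m} (G-rec m) (V-ratio G G₀ G-rec m) n)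

  sumℤ-applyUpTo : ∀ n (g : ℕ → ℤ) (h : ℕ → ℕ) → sumℤ (map g (applyUpTo h (suc n))) ≡ sumUpTo n (g ∘ h)
  sumℤ-applyUpTo zero    g h = ℤ.+-identityʳ (g (h 0))
  sumℤ-applyUpTo (suc n) g h = cong (_+_ (g (h 0))) (sumℤ-applyUpTo n g (h ∘ suc))

  convV≡V⊛ : ∀ f p n → convV f p n ≡ (V p ⊛ (+_ ∘ f)) n
  convV≡V⊛ f p n = trans (sumℤ-applyUpTo n _ id) (sumUpTo-cong n (λ j → ℤ.*-comm (+ f (n ∸ j)) (V p j)))

module Cardinality where

  open import Data.Nat.Base using (zero; pred; _+_; _*_; _≤_; z≤n; s≤s)
  open import Data.Nat.Properties using (0≢1+n)
  open import Data.List.Base using (List; []; _∷_; length; map; _++_; cartesianProduct)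
  open import Data.List.Properties using (length-++; length-map)
  open import Data.List.Membership.Propositional using (_∈_)
  open import Data.List.Membership.Propositional.Properties
    using (∈-++⁻; ∈-++⁺ˡ; ∈-++⁺ʳ; ∈-cartesianProduct⁻; ∈-cartesianProduct⁺; ∈-map⁻; ∈-map⁺)
  open import Data.List.Membership.Propositional.Properties.WithK using (unique∧set⇒bag)
  open import Data.List.Relation.Binary.BagAndSetEquality using (∼bag⇒↭)
  open import Data.List.Relation.Binary.Permutation.Propositional.Properties using (↭-length)
  open import Data.List.Relation.Unary.All as All using (All; []; _∷_)
  open import Data.List.Relation.Unary.AllPairs using ([]; _∷_)
  open import Data.List.Relation.Unary.Any using (here)
  open import Data.List.Relation.Unary.Unique.Propositional using (Unique)
  import Data.List.Relation.Unary.Unique.Propositional.Properties as Unique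
  open import Data.Product.Base using (Σ; ∃-syntax; _×_; _,_)
  open import Data.Sum.Base as Sum using (_⊎_; inj₁; inj₂; [_,_]′)
  open import Function.Base using (_∘_)
  open import Function.Bundles using (_⇔_; mk⇔; Equivalence)
  open import Relation.Nullary using (¬_)
  open import Relation.Binary.PropositionalEquality
  open Equivalence

  Card : {A : Set} → (A → Set) → ℕ → Set
  Card {A} P c = Σ (List A) λ L → Unique L × (∀ x → (x ∈ L) ⇔ P x) × length L ≡ c

  module _ {A : Set} where

    card-unique : ∀ {P : A → Set} {a b} → Card P a → Card P b → a ≡ b
    card-unique (L , L! , L⇔P , ∣L∣) (K , K! , K⇔P , ∣K∣) =
      trans (sym ∣L∣) (trans (↭-length (∼bag⇒↭ (unique∧set⇒bag L! K! L⇔K))) ∣K∣)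
      where
      L⇔K : ∀ {x} → (x ∈ L) ⇔ (x ∈ K)
      L⇔K {x} = mk⇔ (from (K⇔P x) ∘ to (L⇔P x)) (from (L⇔P x) ∘ to (K⇔P x))

    card-resp : ∀ {P Q : A → Set} {c} → (∀ x → P x ⇔ Q x) → Card P c → Card Q c
    card-resp P⇔Q (L , L! , L⇔P , ∣L∣) =
      L , L! , (λ x → mk⇔ (to (P⇔Q x) ∘ to (L⇔P x)) (from (L⇔P x) ∘ from (P⇔Q x))) , ∣L∣

    card-singleton : ∀ {P : A → Set} a → P a → (∀ x → P x → x ≡ a) → Card P 1
    card-singleton a Pa unique =
      a ∷ [] , [] ∷ [] , (λ x → mk⇔ (λ { (here refl) → Pa }) (here ∘ unique x)) , refl

    card-⊎ : ∀ {P Q : A → Set} {a b} → (∀ x → P x → ¬ Q x) → Card P a → Card Q b →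
             Card (λ x → P x ⊎ Q x) (a + b)
    card-⊎ disjoint (L , L! , L⇔P , ∣L∣) (K , K! , K⇔Q , ∣K∣) =
      L ++ K ,
      Unique.++⁺ L! K! (λ (x∈L , x∈K) → disjoint _ (to (L⇔P _) x∈L) (to (K⇔Q _) x∈K)) ,
      (λ x → mk⇔ (Sum.map (to (L⇔P x)) (to (K⇔Q x)) ∘ ∈-++⁻ L)
                 [ ∈-++⁺ˡ ∘ from (L⇔P x) , ∈-++⁺ʳ L ∘ from (K⇔Q x) ]′) ,
      trans (length-++ L) (cong₂ _+_ ∣L∣ ∣K∣)

  length-cartesianProduct : ∀ {A B : Set} (xs : List A) (ys : List B) →
                            length (cartesianProduct xs ys) ≡ length xs * length ys
  length-cartesianProduct []       ys = refl
  length-cartesianProduct (x ∷ xs) ys =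
    trans (length-++ (map (x ,_) ys)) (cong₂ _+_ (length-map (x ,_) ys) (length-cartesianProduct xs ys))

  card-× : ∀ {A B : Set} {P : A → Set} {Q : B → Set} {a b} → Card P a → Card Q b →
           Card (λ (x , y) → P x × Q y) (a * b)
  card-× (L , L! , L⇔P , ∣L∣) (K , K! , K⇔Q , ∣K∣) =
    cartesianProduct L K ,
    Unique.cartesianProduct⁺ L! K! ,
    (λ (x , y) → mk⇔ (λ xy∈ → let (x∈L , y∈K) = ∈-cartesianProduct⁻ L K xy∈
                               in to (L⇔P x) x∈L , to (K⇔Q y) y∈K)
                     (λ (Px , Qy) → ∈-cartesianProduct⁺ (from (L⇔P x) Px) (from (K⇔Q y) Qy))) ,
    trans (length-cartesianProduct L K) (cong₂ _*_ ∣L∣ ∣K∣)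

  map-unique : ∀ {A B : Set} {P : A → Set} (g : A → B) → (∀ {x y} → P x → P y → g x ≡ g y → x ≡ y) →
               ∀ {L} → All P L → Unique L → Unique (map g L)
  map-unique g injective []         []         = []
  map-unique {P = P} g injective (Px ∷ PL) (x∉L ∷ L!) = distinct Px PL x∉L ∷ map-unique g injective PL L!
    where
    distinct : ∀ {x K} → P x → All P K → All (λ y → ¬ x ≡ y) K → All (λ y → ¬ g x ≡ y) (map g K)
    distinct Px []         []            = []
    distinct Px (Py ∷ PK) (x≢y ∷ x∉K) = (x≢y ∘ injective Px Py) ∷ distinct Px PK x∉K

  card-bijection : ∀ {A B : Set} {P : A → Set} {Q : B → Set} {c} (g : A → B) (h : B → A) →
                   (∀ x → P x → Q (g x)) → (∀ y → Q y → P (h y)) →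
                   (∀ x → P x → h (g x) ≡ x) → (∀ y → Q y → g (h y) ≡ y) →
                   Card P c → Card Q c
  card-bijection {Q = Q} g h P→Q Q→P hg≡id gh≡id (L , L! , L⇔P , ∣L∣) =
    map g L ,
    map-unique g (λ Px Py gx≡gy → trans (sym (hg≡id _ Px)) (trans (cong h gx≡gy) (hg≡id _ Py)))
      (All.tabulate (to (L⇔P _))) L! ,
    (λ y → mk⇔ (λ y∈ → let (x , x∈L , y≡gx) = ∈-map⁻ g y∈
                        in subst Q (sym y≡gx) (P→Q x (to (L⇔P x) x∈L)))
               (λ Qy → subst (_∈ map g L) (gh≡id y Qy) (∈-map⁺ g (from (L⇔P (h y)) (Q→P y Qy))))) ,
    trans (length-map g L) ∣L∣

  ∑≤ : ℕ → (ℕ → ℕ) → ℕ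
  ∑≤ zero    c = c 0
  ∑≤ (suc n) c = c 0 + ∑≤ n (c ∘ suc)

  card-⋃≤ : ∀ {A : Set} {Q : ℕ → A → Set} {c : ℕ → ℕ} n →
            (∀ {i k x} → i ≤ n → k ≤ n → Q i x → Q k x → i ≡ k) →
            (∀ i → i ≤ n → Card (Q i) (c i)) →
            Card (λ x → ∃[ i ] i ≤ n × Q i x) (∑≤ n c)
  card-⋃≤ zero Q-disjoint card-Q =
    card-resp (λ x → mk⇔ (λ Q₀x → 0 , z≤n , Q₀x) (λ { (0 , z≤n , Q₀x) → Q₀x })) (card-Q 0 z≤n)
  card-⋃≤ {Q = Q} {c} (suc n) Q-disjoint card-Q =
    card-resp (λ x → mk⇔ [ (λ Q₀x → 0 , z≤n , Q₀x) , (λ (i , i≤n , Qx) → suc i , s≤s i≤n , Qx) ]′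
                         split)
      (card-⊎ (λ x Q₀x (i , i≤n , Qx) → 0≢1+n (Q-disjoint z≤n (s≤s i≤n) Q₀x Qx))
              (card-Q 0 z≤n)
              (card-⋃≤ {Q = Q ∘ suc} {c ∘ suc} n Q∘suc-disjoint (λ i i≤n → card-Q (suc i) (s≤s i≤n))))
    where
    Q∘suc-disjoint : ∀ {i k x} → i ≤ n → k ≤ n → Q (suc i) x → Q (suc k) x → i ≡ k
    Q∘suc-disjoint i≤n k≤n Qix Qkx = cong pred (Q-disjoint (s≤s i≤n) (s≤s k≤n) Qix Qkx)
    split : ∀ {x} → ∃[ i ] i ≤ suc n × Q i x → Q 0 x ⊎ ∃[ i ] i ≤ n × Q (suc i) x
    split (zero  , _         , Qx) = inj₁ Qx
    split (suc i , s≤s i≤n , Qx) = inj₂ (i , i≤n , Qx)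

module Avoidance where

  open import Data.Nat.Base using (zero; _+_; _*_; _∸_; _⊓_; _≤_; _<_; z≤n; s≤s; z<s)
  open import Data.Nat using (_<?_)
  open import Data.Nat.Properties
  open import Data.Fin.Base as Fin using (Fin; toℕ; fromℕ; fromℕ<; inject₁; punchIn) renaming (_<_ to _<ᶠ_)
  open import Data.Fin.Properties
    using ( toℕ-inject₁; toℕ-fromℕ; toℕ<n; toℕ-injective; toℕ-fromℕ<; ≤fromℕ
          ; injective⇒≤; injective⇒existsPivot; ¬Fin0)
  open import Data.Nat.Induction using (<-rec)
  open import Data.Fin.Patterns using (0F; 1F; 2F)
  open import Data.Fin.Relation.Unary.Top using (view; ‵fromℕ; ‵inject₁)
  open import Data.Vec.Base using ([]; lookup; tabulate)
  open import Data.Vec.Properties using (lookup∘tabulate; tabulate-cong; tabulate∘lookup)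
  open import Data.Vec.Functional using (insertAt)
  open import Data.Vec.Functional.Properties using (insertAt-lookup; insertAt-punchIn)
  open import Data.Bool.Base using (false)
  open import Data.Product.Base using (∃; ∃-syntax; _×_; _,_; proj₁; proj₂)
  open import Data.Sum.Base using (_⊎_; inj₁; inj₂; [_,_]′)
  open import Function.Base using (_∘_; id)
  open import Function.Bundles using (_⇔_; mk⇔; Equivalence)
  open import Function.Construct.Composition using (_⇔-∘_)
  open import Function.Construct.Symmetry using (⇔-sym)
  open import Relation.Nullary using (¬_; contradiction; yes; no)
  open import Relation.Binary.Definitions using (tri<; tri≈; tri>)
  open import Relation.Binary.PropositionalEquality
  open Equivalence
  open Cardinality

  both : ∀ {A B : Set} → A → B → A ⇔ B
  both a b = mk⇔ (λ _ → b) (λ _ → a)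

  neither : ∀ {A B : Set} → ¬ A → ¬ B → A ⇔ B
  neither ¬a ¬b = mk⇔ (λ a → contradiction a ¬a) (λ b → contradiction b ¬b)

  -- Words are functions ℕ → ℕ of which only the first N values matter.
  record Occurrence (N : ℕ) (w : ℕ → ℕ) (τ : GPattern) (ι : Fin (len τ) → ℕ) : Set where
    field
      in-range   : ∀ a → ι a < N
      increasing : ∀ a b → a <ᶠ b → ι a < ι b
      order-iso  : ∀ a b → (letter τ a < letter τ b) ⇔ (w (ι a) < w (ι b))
      adjacent   : ∀ a b → toℕ b ≡ suc (toℕ a) → dash τ a ≡ false → ι b ≡ suc (ι a)
  open Occurrence public

  Occurs : ℕ → (ℕ → ℕ) → GPattern → Set
  Occurs N w τ = ∃ (Occurrence N w τ)

  record Avoider (τ : GPattern) (n : ℕ) (w : ℕ → ℕ) : Set where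
    field
      bounded    : ∀ {p} → p < n → w p < n
      injective  : ∀ {p q} → p < n → q < n → w p ≡ w q → p ≡ q
      avoids-132 : ¬ Occurs n w p1-3-2
      avoids-τ   : ¬ Occurs n w τ
  open Avoider public

  increasing-≤ : ∀ {N w τ ι} → Occurrence N w τ ι → ∀ a b → toℕ a ≤ toℕ b → ι a ≤ ι b
  increasing-≤ o a b a≤b with m≤n⇒m<n∨m≡n a≤b
  ... | inj₁ a<b = <⇒≤ (increasing o a b a<b)
  ... | inj₂ a≡b = ≤-reflexive (cong _ (toℕ-injective a≡b))

  module Window {a s c : ℕ} {w σ : ℕ → ℕ} (shift : ∀ {p} → p < a → w (s + p) ≡ σ p + c) where

    +-monoˡ-⇔ : ∀ x y → (x < y) ⇔ (x + c < y + c)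
    +-monoˡ-⇔ x y = mk⇔ (+-monoˡ-< c) (+-cancelʳ-< c x y)

    lift-occurrence : ∀ {N τ ι} → s + a ≤ N → Occurrence a σ τ ι → Occurrence N w τ ((s +_) ∘ ι)
    lift-occurrence s+a≤N o = record
      { in-range   = λ x → <-≤-trans (+-monoʳ-< s (in-range o x)) s+a≤N
      ; increasing = λ x y x<y → +-monoʳ-< s (increasing o x y x<y)
      ; order-iso  = λ x y → subst (_ ⇔_) (sym (cong₂ _<_ (shift (in-range o x)) (shift (in-range o y))))
                               (+-monoˡ-⇔ _ _ ⇔-∘ order-iso o x y)
      ; adjacent   = λ x y y≡x+1 d → trans (cong (s +_) (adjacent o x y y≡x+1 d)) (+-suc s _)
      }

    lower-occurrence : ∀ {N τ ι} → Occurrence N w τ ι → (∀ x → s ≤ ι x) → (∀ x → ι x < s + a) →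
                       Occurrence a σ τ ((_∸ s) ∘ ι)
    lower-occurrence {ι = ι} o s≤ι ι<s+a = record
      { in-range   = in-window
      ; increasing = λ x y x<y → ∸-monoˡ-< (increasing o x y x<y) (s≤ι x)
      ; order-iso  = λ x y → ⇔-sym (+-monoˡ-⇔ _ _)
                               ⇔-∘ subst (_ ⇔_) (cong₂ _<_ (unshift x) (unshift y)) (order-iso o x y)
      ; adjacent   = λ x y y≡x+1 d → trans (cong (_∸ s) (adjacent o x y y≡x+1 d)) (+-∸-assoc 1 (s≤ι x))
      }
      where
      in-window : ∀ x → ι x ∸ s < a
      in-window x = +-cancelˡ-< s _ _ (subst (_< s + a) (sym (m+[n∸m]≡n (s≤ι x))) (ι<s+a x))
      unshift : ∀ x → w (ι x) ≡ σ (ι x ∸ s) + c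
      unshift x = trans (cong w (sym (m+[n∸m]≡n (s≤ι x)))) (shift (in-window x))

    avoids-window : ∀ {N τ} → s + a ≤ N → ¬ Occurs N w τ → ¬ Occurs a σ τ
    avoids-window s+a≤N ¬occ (ι , o) = ¬occ (_ , lift-occurrence s+a≤N o)

  avoider-cong : ∀ {τ n w w′} → (∀ {p} → p < n → w p ≡ w′ p) → Avoider τ n w → Avoider τ n w′
  avoider-cong {n = n} {w} {w′} w≗w′ A = record
    { bounded    = λ p<n → subst (_< n) (w≗w′ p<n) (bounded A p<n)
    ; injective  = λ p<n q<n eq → injective A p<n q<n (trans (w≗w′ p<n) (trans eq (sym (w≗w′ q<n))))
    ; avoids-132 = avoids-window ≤-refl (avoids-132 A)
    ; avoids-τ   = avoids-window ≤-refl (avoids-τ A)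
    }
    where
    open Window {a = n} {s = 0} {c = 0} {w = w} {σ = w′} (λ p<n → trans (w≗w′ p<n) (sym (+-identityʳ _)))

  132-occurrence : ∀ {N w p₀ p₁ p₂} → p₀ < p₁ → p₁ < p₂ → p₂ < N →
                   w p₀ < w p₂ → w p₂ < w p₁ → Occurs N w p1-3-2
  132-occurrence {N} {w} {p₀} {p₁} {p₂} p₀<p₁ p₁<p₂ p₂<N v₀<v₂ v₂<v₁ = ι , record
    { in-range   = in-range′
    ; increasing = increasing′
    ; order-iso  = order-iso′
    ; adjacent   = λ _ _ _ ()
    }
    where
    ι : Fin 3 → ℕ
    ι 0F = p₀
    ι 1F = p₁
    ι 2F = p₂
    in-range′ : ∀ a → ι a < N
    in-range′ 0F = <-trans p₀<p₁ (<-trans p₁<p₂ p₂<N)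
    in-range′ 1F = <-trans p₁<p₂ p₂<N
    in-range′ 2F = p₂<N
    increasing′ : ∀ a b → a <ᶠ b → ι a < ι b
    increasing′ _  0F ()
    increasing′ 0F 1F _              = p₀<p₁
    increasing′ 0F 2F _              = <-trans p₀<p₁ p₁<p₂
    increasing′ 1F 1F (s≤s ())
    increasing′ 1F 2F _              = p₁<p₂
    increasing′ 2F 1F (s≤s ())
    increasing′ 2F 2F (s≤s (s≤s ()))
    v₀<v₁ = <-trans v₀<v₂ v₂<v₁
    order-iso′ : ∀ a b → (letter p1-3-2 a < letter p1-3-2 b) ⇔ (w (ι a) < w (ι b))
    order-iso′ 0F 0F = neither (<-irrefl refl) (<-irrefl refl)
    order-iso′ 0F 1F = both (s≤s (s≤s z≤n)) v₀<v₁
    order-iso′ 0F 2F = both (s≤s (s≤s z≤n)) v₀<v₂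
    order-iso′ 1F 0F = neither (λ { (s≤s ()) }) (<-asym v₀<v₁)
    order-iso′ 1F 1F = neither (<-irrefl refl) (<-irrefl refl)
    order-iso′ 1F 2F = neither (λ { (s≤s (s≤s ())) }) (<-asym v₂<v₁)
    order-iso′ 2F 0F = neither (λ { (s≤s ()) }) (<-asym v₀<v₂)
    order-iso′ 2F 1F = both (s≤s (s≤s (s≤s z≤n))) v₂<v₁
    order-iso′ 2F 2F = neither (<-irrefl refl) (<-irrefl refl)

  -- Two adjacent positions witness τ whether or not it has a dash.
  adjacent-occurrence : ∀ {N w p} t → suc p < N →
                        (first t < second t) ⇔ (w p < w (suc p)) → (second t < first t) ⇔ (w (suc p) < w p) →
                        Occurs N w (extPattern t 0)
  adjacent-occurrence {N} {w} {p} t p+1<N ascent⇔ descent⇔ = ι , record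
    { in-range   = in-range′
    ; increasing = increasing′
    ; order-iso  = order-iso′
    ; adjacent   = adjacent′
    }
    where
    ι : Fin 2 → ℕ
    ι 0F = p
    ι 1F = suc p
    in-range′ : ∀ a → ι a < N
    in-range′ 0F = <-trans (n<1+n p) p+1<N
    in-range′ 1F = p+1<N
    increasing′ : ∀ a b → a <ᶠ b → ι a < ι b
    increasing′ _  0F ()
    increasing′ 0F 1F _        = n<1+n p
    increasing′ 1F 1F (s≤s ())
    order-iso′ : ∀ a b → (letter (extPattern t 0) a < letter (extPattern t 0) b) ⇔ (w (ι a) < w (ι b))
    order-iso′ 0F 0F = neither (<-irrefl refl) (<-irrefl refl)
    order-iso′ 0F 1F = ascent⇔
    order-iso′ 1F 0F = descent⇔
    order-iso′ 1F 1F = neither (<-irrefl refl) (<-irrefl refl)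
    adjacent′ : ∀ a b → toℕ b ≡ suc (toℕ a) → dash (extPattern t 0) a ≡ false → ι b ≡ suc (ι a)
    adjacent′ 0F 1F _ _ = refl
    adjacent′ 0F 0F ()
    adjacent′ 1F _  _ ()

  first≤2 : ∀ t → first t ≤ 2
  first≤2 t12  = s≤s z≤n
  first≤2 t1-2 = s≤s z≤n
  first≤2 t21  = s≤s (s≤s z≤n)
  first≤2 t2-1 = s≤s (s≤s z≤n)

  second≤2 : ∀ t → second t ≤ 2
  second≤2 t12  = s≤s (s≤s z≤n)
  second≤2 t1-2 = s≤s (s≤s z≤n)
  second≤2 t21  = s≤s z≤n
  second≤2 t2-1 = s≤s z≤n

  punchIn-fromℕ : ∀ {k} (a : Fin k) → punchIn (fromℕ k) a ≡ inject₁ a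
  punchIn-fromℕ 0F          = refl
  punchIn-fromℕ (Fin.suc a) = cong Fin.suc (punchIn-fromℕ a)

  inject₁-mono : ∀ {k} {a b : Fin k} → a <ᶠ b → inject₁ a <ᶠ inject₁ b
  inject₁-mono {a = a} {b} = subst₂ _<_ (sym (toℕ-inject₁ a)) (sym (toℕ-inject₁ b))

  module _ (t : Tau) (m : ℕ) where

    letter-inject₁ : ∀ a → letter (extPattern t (suc m)) (inject₁ a) ≡ letter (extPattern t m) a
    letter-inject₁ 0F                    = refl
    letter-inject₁ 1F                    = refl
    letter-inject₁ (Fin.suc (Fin.suc a)) = cong (3 +_) (toℕ-inject₁ a)

    letter-fromℕ : letter (extPattern t (suc m)) (fromℕ (suc (suc m))) ≡ 3 + m
    letter-fromℕ = cong (3 +_) (toℕ-fromℕ m)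

    letter<3+m : ∀ a → letter (extPattern t m) a < 3 + m
    letter<3+m 0F                    = s≤s (≤-trans (first≤2 t) (m≤m+n 2 m))
    letter<3+m 1F                    = s≤s (≤-trans (second≤2 t) (m≤m+n 2 m))
    letter<3+m (Fin.suc (Fin.suc a)) = +-monoʳ-< 3 (toℕ<n a)

    drop-last : ∀ {N w ι} → Occurrence N w (extPattern t (suc m)) ι →
                Occurrence N w (extPattern t m) (ι ∘ inject₁)
    drop-last o = record
      { in-range   = in-range o ∘ inject₁
      ; increasing = λ a b a<b → increasing o _ _ (inject₁-mono a<b)
      ; order-iso  = λ a b → subst (_⇔ _) (cong₂ _<_ (letter-inject₁ a) (letter-inject₁ b))
                                   (order-iso o (inject₁ a) (inject₁ b))
      ; adjacent   = adjacent′
      }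
      where
      adjacent′ : ∀ a b → toℕ b ≡ suc (toℕ a) → dash (extPattern t m) a ≡ false → _
      adjacent′ 0F          1F                    b≡a+1 d = adjacent o 0F 1F b≡a+1 d
      adjacent′ 0F          0F                    ()
      adjacent′ 0F          (Fin.suc (Fin.suc _)) ()
      adjacent′ (Fin.suc _) _                     _     ()

    append-top : ∀ {N w ι q} → Occurrence N w (extPattern t m) ι → q < N →
                 (∀ a → ι a < q) → (∀ a → w (ι a) < w q) → Occurs N w (extPattern t (suc m))
    append-top {N} {w} {ι} {q} o q<N ι<q wι<wq = ι′ , record
      { in-range   = in-range′
      ; increasing = increasing′
      ; order-iso  = order-iso′
      ; adjacent   = adjacent′
      }
      where
      K = suc (suc m)
      ι′ : Fin (suc K) → ℕ
      ι′ = insertAt ι (fromℕ K) q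
      ι′-inject₁ : ∀ a → ι′ (inject₁ a) ≡ ι a
      ι′-inject₁ a = trans (cong ι′ (sym (punchIn-fromℕ a))) (insertAt-punchIn ι (fromℕ K) q a)
      ι′-top : ι′ (fromℕ K) ≡ q
      ι′-top = insertAt-lookup ι (fromℕ K) q
      top≮ : ∀ {a} → ¬ fromℕ K <ᶠ inject₁ a
      top≮ {a} l = <⇒≱ l (≤fromℕ (inject₁ a))
      in-range′ : ∀ a → ι′ a < N
      in-range′ a with view a
      ... | ‵fromℕ      = subst (_< N) (sym ι′-top) q<N
      ... | ‵inject₁ a′ = subst (_< N) (sym (ι′-inject₁ a′)) (<-trans (ι<q a′) q<N)
      increasing′ : ∀ a b → a <ᶠ b → ι′ a < ι′ b
      increasing′ a b a<b with view a | view b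
      ... | ‵inject₁ a′ | ‵inject₁ b′ =
        subst₂ _<_ (sym (ι′-inject₁ a′)) (sym (ι′-inject₁ b′))
          (increasing o a′ b′ (subst₂ _<_ (toℕ-inject₁ a′) (toℕ-inject₁ b′) a<b))
      ... | ‵inject₁ a′ | ‵fromℕ      = subst₂ _<_ (sym (ι′-inject₁ a′)) (sym ι′-top) (ι<q a′)
      ... | ‵fromℕ      | ‵inject₁ b′ = contradiction a<b top≮
      ... | ‵fromℕ      | ‵fromℕ      = contradiction a<b (<-irrefl refl)
      order-iso′ : ∀ a b → (letter (extPattern t (suc m)) a < letter (extPattern t (suc m)) b) ⇔
                           (w (ι′ a) < w (ι′ b))
      order-iso′ a b with view a | view b
      ... | ‵inject₁ a′ | ‵inject₁ b′ =
        subst₂ _⇔_ (sym (cong₂ _<_ (letter-inject₁ a′) (letter-inject₁ b′)))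
                   (sym (cong₂ (λ u v → w u < w v) (ι′-inject₁ a′) (ι′-inject₁ b′)))
                   (order-iso o a′ b′)
      ... | ‵inject₁ a′ | ‵fromℕ      =
        both (subst₂ _<_ (sym (letter-inject₁ a′)) (sym letter-fromℕ) (letter<3+m a′))
             (subst₂ (λ u v → w u < w v) (sym (ι′-inject₁ a′)) (sym ι′-top) (wι<wq a′))
      ... | ‵fromℕ      | ‵inject₁ b′ =
        neither (λ l → <-asym (letter<3+m b′) (subst₂ _<_ letter-fromℕ (letter-inject₁ b′) l))
                (λ l → <-asym (wι<wq b′) (subst₂ (λ u v → w u < w v) ι′-top (ι′-inject₁ b′) l))
      ... | ‵fromℕ      | ‵fromℕ      = neither (<-irrefl refl) (<-irrefl refl)
      adjacent′ : ∀ a b → toℕ b ≡ suc (toℕ a) → dash (extPattern t (suc m)) a ≡ false →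
                  ι′ b ≡ suc (ι′ a)
      adjacent′ 0F          1F                    b≡a+1 d = adjacent o 0F 1F b≡a+1 d
      adjacent′ 0F          0F                    ()
      adjacent′ 0F          (Fin.suc (Fin.suc _)) ()
      adjacent′ (Fin.suc _) _                     _     ()

  -- Decomposition at the maximum

  pigeonhole : ∀ {a b} (f : ℕ → ℕ) → (∀ {x} → x < a → f x < b) →
               (∀ {x y} → x < a → y < a → f x ≡ f y → x ≡ y) → a ≤ b
  pigeonhole {a} {b} f f<b f-injective = injective⇒≤ f′-injective
    where
    f′ : Fin a → Fin b
    f′ x = fromℕ< (f<b (toℕ<n x))
    f′-injective : ∀ {x y} → f′ x ≡ f′ y → x ≡ y
    f′-injective {x} {y} eq = toℕ-injective (f-injective (toℕ<n x) (toℕ<n y)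
      (trans (sym (toℕ-fromℕ< _)) (trans (cong toℕ eq) (toℕ-fromℕ< _))))

  pigeonhole-window : ∀ {N} {w : ℕ → ℕ} {k s e lo hi} →
                      (∀ {p q} → p < N → q < N → w p ≡ w q → p ≡ q) →
                      s + k ≤ N → e < N → e < s ⊎ s + k ≤ e →
                      (∀ {x} → x < k → lo ≤ w (s + x) × w (s + x) < hi) → lo ≤ w e → w e < hi →
                      k + lo < hi
  pigeonhole-window {N} {w} {k} {s} {e} {lo} {hi} w-injective s+k≤N e<N e∉window in-window lo≤we we<hi =
    m≤o∸n⇒m+n≤o (suc k) (≤-trans lo≤we (<⇒≤ we<hi))
      (pigeonhole (λ x → w (pos x) ∸ lo) (λ x≤k → ∸-monoˡ-< (pos-hi x≤k) (pos-lo x≤k)) f-injective)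
    where
    pos : ℕ → ℕ
    pos x with x <? k
    ... | yes _ = s + x
    ... | no  _ = e
    pos-lo : ∀ {x} → x < suc k → lo ≤ w (pos x)
    pos-lo {x} _ with x <? k
    ... | yes x<k = proj₁ (in-window x<k)
    ... | no  _   = lo≤we
    pos-hi : ∀ {x} → x < suc k → w (pos x) < hi
    pos-hi {x} _ with x <? k
    ... | yes x<k = proj₂ (in-window x<k)
    ... | no  _   = we<hi
    pos<N : ∀ {x} → x < suc k → pos x < N
    pos<N {x} _ with x <? k
    ... | yes x<k = <-≤-trans (+-monoʳ-< s x<k) s+k≤N
    ... | no  _   = e<N
    outside : ∀ {x} → x < k → s + x ≢ e
    outside x<k s+x≡e =
      [ (λ e<s → <⇒≱ e<s (subst (s ≤_) s+x≡e (m≤m+n s _)))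
      , (λ s+k≤e → <⇒≱ (+-monoʳ-< s x<k) (subst (s + k ≤_) (sym s+x≡e) s+k≤e))
      ]′ e∉window
    pos-injective : ∀ {x y} → x < suc k → y < suc k → pos x ≡ pos y → x ≡ y
    pos-injective {x} {y} x≤k y≤k eq with x <? k | y <? k
    ... | yes _   | yes _   = +-cancelˡ-≡ s x y eq
    ... | yes x<k | no  _   = contradiction eq (outside x<k)
    ... | no  _   | yes y<k = contradiction (sym eq) (outside y<k)
    ... | no  x≮k | no  y≮k =
      trans (≤-antisym (≤-pred x≤k) (≮⇒≥ x≮k)) (sym (≤-antisym (≤-pred y≤k) (≮⇒≥ y≮k)))
    f-injective : ∀ {x y} → x < suc k → y < suc k → w (pos x) ∸ lo ≡ w (pos y) ∸ lo → x ≡ y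
    f-injective x≤k y≤k eq =
      pos-injective x≤k y≤k (w-injective (pos<N x≤k) (pos<N y≤k) (∸-cancelʳ-≡ (pos-lo x≤k) (pos-lo y≤k) eq))

  glue : (i j n : ℕ) → (α β : ℕ → ℕ) → ℕ → ℕ
  glue zero    j n α β zero    = n
  glue zero    j n α β (suc p) = β p
  glue (suc i) j n α β zero    = α 0 + j
  glue (suc i) j n α β (suc p) = glue i j n (α ∘ suc) β p

  glue-left : ∀ i {j n α β p} → p < i → glue i j n α β p ≡ α p + j
  glue-left (suc i) {p = zero}  _           = refl
  glue-left (suc i) {p = suc p} (s≤s p<i) = glue-left i p<i

  glue-top : ∀ i {j n α β} → glue i j n α β i ≡ n
  glue-top zero    = refl
  glue-top (suc i) = glue-top i

  glue-right : ∀ i {j n α β} p → glue i j n α β (suc (i + p)) ≡ β p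
  glue-right zero    p = refl
  glue-right (suc i) p = glue-right i p

  module Decomposition (t : Tau) (m : ℕ) {i j n : ℕ} (i+j≡n : i + j ≡ n) where

    record Splitting (w α β : ℕ → ℕ) : Set where
      field
        left  : ∀ {p} → p < i → w p ≡ α p + j
        top   : w i ≡ n
        right : ∀ {p} → p < j → w (suc (i + p)) ≡ β p
    open Splitting

    glue-splitting : ∀ α β → Splitting (glue i j n α β) α β
    glue-splitting α β = record { left = glue-left i ; top = glue-top i ; right = λ {p} _ → glue-right i p }

    data Position : ℕ → Set where
      before : ∀ {p} → p < i → Position p
      at-top : Position i
      after  : ∀ {p} → p < j → Position (suc (i + p))

    i<N : i < suc n
    i<N = s≤s (subst (i ≤_) i+j≡n (m≤m+n i j))

    j≤n : j ≤ n
    j≤n = subst (j ≤_) i+j≡n (m≤n+m j i)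

    before<N : ∀ {p} → p < i → p < suc n
    before<N p<i = <-trans p<i i<N

    after<N : ∀ {p} → p < j → suc (i + p) < suc n
    after<N p<j = s≤s (subst (i + _ <_) i+j≡n (+-monoʳ-< i p<j))

    position : ∀ {q} → q < suc n → Position q
    position {q} q<N with <-cmp q i
    ... | tri< q<i _ _  = before q<i
    ... | tri≈ _ refl _ = at-top
    ... | tri> _ _ i<q  = subst Position (m+[n∸m]≡n i<q) (after q∸i-1<j)
      where
      q∸i-1<j : q ∸ suc i < j
      q∸i-1<j = subst (q ∸ suc i <_) (trans (cong (_∸ i) (sym i+j≡n)) (m+n∸m≡n i j)) (∸-monoˡ-< q<N i<q)

    module Left  {w α β : ℕ → ℕ} (S : Splitting w α β) = Window {i} {0} {j} {w} {α} (left S)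
    module Right {w α β : ℕ → ℕ} (S : Splitting w α β) =
      Window {j} {suc i} {0} {w} {β} (λ {p} p<j → trans (right S p<j) (sym (+-identityʳ (β p))))

    left-fits : 0 + i ≤ suc n
    left-fits = <⇒≤ i<N

    right-fits : suc i + j ≤ suc n
    right-fits = ≤-reflexive (cong suc i+j≡n)

    module Compose {w α β : ℕ → ℕ} (S : Splitting w α β)
                   (A : Avoider (extPattern t m) i α) (B : Avoider (extPattern t (suc m)) j β) where

      j≤before : ∀ {p} → p < i → j ≤ w p
      j≤before {p} p<i = subst (j ≤_) (sym (left S p<i)) (m≤n+m j (α p))
      before<n : ∀ {p} → p < i → w p < n
      before<n p<i = subst₂ _<_ (sym (left S p<i)) i+j≡n (+-monoˡ-< j (bounded A p<i))
      after<j : ∀ {p} → p < j → w (suc (i + p)) < j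
      after<j p<j = subst (_< j) (sym (right S p<j)) (bounded B p<j)
      after<n : ∀ {p} → p < j → w (suc (i + p)) < n
      after<n p<j = <-≤-trans (after<j p<j) j≤n

      bounded′ : ∀ {q} → q < suc n → w q < suc n
      bounded′ q<N with position q<N
      ... | before p<i = m<n⇒m<1+n (before<n p<i)
      ... | at-top     = subst (_< suc n) (sym (top S)) (n<1+n n)
      ... | after p<j  = m<n⇒m<1+n (after<n p<j)

      injective′ : ∀ {p q} → p < suc n → q < suc n → w p ≡ w q → p ≡ q
      injective′ p<N q<N eq with position p<N | position q<N
      ... | before p<i | before q<i =
        injective A p<i q<i (+-cancelʳ-≡ j _ _ (trans (sym (left S p<i)) (trans eq (left S q<i))))
      ... | before p<i | at-top     = contradiction (trans eq (top S)) (<⇒≢ (before<n p<i))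
      ... | before p<i | after q<j  = contradiction (sym eq) (<⇒≢ (<-≤-trans (after<j q<j) (j≤before p<i)))
      ... | at-top     | before q<i = contradiction (trans (sym eq) (top S)) (<⇒≢ (before<n q<i))
      ... | at-top     | at-top     = refl
      ... | at-top     | after q<j  = contradiction (trans (sym eq) (top S)) (<⇒≢ (after<n q<j))
      ... | after p<j  | before q<i = contradiction eq (<⇒≢ (<-≤-trans (after<j p<j) (j≤before q<i)))
      ... | after p<j  | at-top     = contradiction (trans eq (top S)) (<⇒≢ (after<n p<j))
      ... | after p<j  | after q<j  =
        cong (suc ∘ (i +_)) (injective B p<j q<j (trans (sym (right S p<j)) (trans eq (right S q<j))))

      ascent-within : ∀ {p q} → p < q → q < suc n → w p < w q → q ≤ i ⊎ i < p
      ascent-within p<q q<N wp<wq with position q<N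
      ... | before q<i = inj₁ (<⇒≤ q<i)
      ... | at-top     = inj₁ ≤-refl
      ... | after q<j with position (<-trans p<q q<N)
      ...   | before p<i  = contradiction (<-≤-trans (after<j q<j) (j≤before p<i)) (<-asym wp<wq)
      ...   | at-top      = contradiction (subst (_< _) (top S) wp<wq) (<-asym (after<n q<j))
      ...   | after _     = inj₂ (s≤s (m≤m+n i _))

      within-left : ∀ {τ ι} → Occurrence (suc n) w τ ι → (∀ x → ι x < i) → Occurs i α τ
      within-left o ι<i = _ , Left.lower-occurrence S o (λ _ → z≤n) ι<i

      within-right : ∀ {τ ι} → Occurrence (suc n) w τ ι → (∀ x → i < ι x) → Occurs j β τ
      within-right {ι = ι} o i<ι =
        _ , Right.lower-occurrence S o i<ι (λ x → subst (ι x <_) (cong suc (sym i+j≡n)) (in-range o x))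

      avoids-132′ : ¬ Occurs (suc n) w p1-3-2
      avoids-132′ (ι , o) with ascent-within (increasing o 0F 2F (s≤s z≤n)) (in-range o 2F)
                                             (to (order-iso o 0F 2F) (s≤s (s≤s z≤n)))
      ... | inj₂ i<ι₀ = avoids-132 B (within-right o (λ x → <-≤-trans i<ι₀ (increasing-≤ o 0F x z≤n)))
      ... | inj₁ ι₂≤i with m≤n⇒m<n∨m≡n ι₂≤i
      ...   | inj₁ ι₂<i =
        avoids-132 A (within-left o (λ x → ≤-<-trans (increasing-≤ o x 2F (≤-pred (toℕ<n x))) ι₂<i))
      ...   | inj₂ ι₂≡i =
        <⇒≱ (to (order-iso o 2F 1F) (s≤s (s≤s (s≤s z≤n))))
            (subst (w (ι 1F) ≤_) (sym (trans (cong w ι₂≡i) (top S))) (≤-pred (bounded′ (in-range o 1F))))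

      avoids-τ′ : ¬ Occurs (suc n) w (extPattern t (suc m))
      avoids-τ′ (ι , o) with ascent-within (increasing o 0F last 0<last) (in-range o last)
                                           (to (order-iso o 0F last) first<last)
        where
        last : Fin (suc (suc (suc m)))
        last = fromℕ (suc (suc m))
        0<last : Fin.zero {suc (suc m)} <ᶠ last
        0<last = subst (0 <_) (sym (toℕ-fromℕ (suc (suc m)))) (s≤s z≤n)
        first<last : first t < letter (extPattern t (suc m)) last
        first<last = subst (first t <_) (sym (letter-fromℕ t m)) (letter<3+m t m 0F)
      ... | inj₂ i<ι₀  = avoids-τ B (within-right o (λ x → <-≤-trans i<ι₀ (increasing-≤ o 0F x z≤n)))
      ... | inj₁ ιₖ≤i = avoids-τ A (within-left (drop-last t m o)
                                      (λ x → <-≤-trans (increasing o _ _ (inject₁<fromℕ x)) ιₖ≤i))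
        where
        inject₁<fromℕ : ∀ x → inject₁ x <ᶠ fromℕ (suc (suc m))
        inject₁<fromℕ x = subst₂ _<_ (sym (toℕ-inject₁ x)) (sym (toℕ-fromℕ _)) (toℕ<n x)

      avoider : Avoider (extPattern t (suc m)) (suc n) w
      avoider = record
        { bounded    = bounded′
        ; injective  = injective′
        ; avoids-132 = avoids-132′
        ; avoids-τ   = avoids-τ′
        }

    module Decompose {w : ℕ → ℕ} (A : Avoider (extPattern t (suc m)) (suc n) w) (wi≡n : w i ≡ n) where

      below-top : ∀ {q} → q < suc n → q ≢ i → w q < n
      below-top q<N q≢i =
        ≤∧≢⇒< (≤-pred (bounded A q<N)) (λ wq≡n → q≢i (injective A q<N i<N (trans wq≡n (sym wi≡n))))

      left-above-right : ∀ {p q} → p < i → i < q → q < suc n → w q < w p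
      left-above-right {p} {q} p<i i<q q<N with <-cmp (w p) (w q)
      ... | tri> _ _ wq<wp = wq<wp
      ... | tri≈ _ wp≡wq _ = contradiction (injective A (before<N p<i) q<N wp≡wq) (<⇒≢ (<-trans p<i i<q))
      ... | tri< wp<wq _ _ = contradiction (132-occurrence p<i i<q q<N wp<wq wq<wi) (avoids-132 A)
        where
        wq<wi : w q < w i
        wq<wi = subst (w q <_) (sym wi≡n) (below-top q<N (>⇒≢ i<q))

      -- Positions after i together with p carry j + 1 distinct values, all at most w p.
      j≤left : ∀ {p} → p < i → j ≤ w p
      j≤left {p} p<i = ≤-pred (subst (_< suc (w p)) (+-identityʳ j)
        (pigeonhole-window (injective A) right-fits (before<N p<i) (inj₁ (m<n⇒m<1+n p<i))
           (λ x<j → z≤n , m<n⇒m<1+n (left-above-right p<i (s≤s (m≤m+n i _)) (after<N x<j)))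
           z≤n (n<1+n (w p))))

      -- Positions up to i together with q carry i + 2 distinct values, all at least w q.
      right<j : ∀ {p} → p < j → w (suc (i + p)) < j
      right<j {p} p<j = +-cancelˡ-< i _ _ (subst (i + w (suc (i + p)) <_) (sym i+j≡n) (≤-pred
        (pigeonhole-window (injective A) i<N (after<N p<j) (inj₂ (s≤s (m≤m+n i p)))
           (λ x≤i → above x≤i , bounded A (<-≤-trans x≤i i<N))
           ≤-refl (bounded A (after<N p<j)))))
        where
        q = suc (i + p)
        above : ∀ {x} → x < suc i → w q ≤ w x
        above {x} x≤i with m<1+n⇒m<n∨m≡n x≤i
        ... | inj₁ x<i  = <⇒≤ (left-above-right x<i (s≤s (m≤m+n i p)) (after<N p<j))
        ... | inj₂ refl = subst (w q ≤_) (sym wi≡n) (≤-pred (bounded A (after<N p<j)))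

      splitting : Splitting w (λ p → w p ∸ j) (λ p → w (suc (i + p)))
      splitting = record { left = λ p<i → sym (m∸n+n≡m (j≤left p<i)) ; top = wi≡n ; right = λ _ → refl }

      left-avoider : Avoider (extPattern t m) i (λ p → w p ∸ j)
      left-avoider = record
        { bounded    = λ p<i → subst (_ <_) n∸j≡i (∸-monoˡ-< (below-top (before<N p<i) (<⇒≢ p<i)) (j≤left p<i))
        ; injective  = λ p<i q<i eq →
                         injective A (before<N p<i) (before<N q<i) (∸-cancelʳ-≡ (j≤left p<i) (j≤left q<i) eq)
        ; avoids-132 = Left.avoids-window splitting left-fits (avoids-132 A)
        ; avoids-τ   = λ (ι , o) → avoids-τ A (append-top t m (Left.lift-occurrence splitting left-fits o) i<N
                                     (in-range o) (below-top-left o))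
        }
        where
        below-top-left : ∀ {τ ι} → Occurrence i (λ p → w p ∸ j) τ ι → ∀ x → w (ι x) < w i
        below-top-left o x = subst (_ <_) (sym wi≡n) (below-top (before<N (in-range o x)) (<⇒≢ (in-range o x)))
        n∸j≡i : n ∸ j ≡ i
        n∸j≡i = trans (cong (_∸ j) (sym i+j≡n)) (m+n∸n≡m i j)

      right-avoider : Avoider (extPattern t (suc m)) j (λ p → w (suc (i + p)))
      right-avoider = record
        { bounded    = right<j
        ; injective  = λ p<j q<j eq →
                         +-cancelˡ-≡ i _ _ (suc-injective (injective A (after<N p<j) (after<N q<j) eq))
        ; avoids-132 = Right.avoids-window splitting right-fits (avoids-132 A)
        ; avoids-τ   = Right.avoids-window splitting right-fits (avoids-τ A)
        }

    splitting-unique : ∀ {w w′ α α′ β β′} → Splitting w α β → Splitting w′ α′ β′ →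
                       (∀ {p} → p < i → α p ≡ α′ p) → (∀ {p} → p < j → β p ≡ β′ p) →
                       ∀ {q} → q < suc n → w q ≡ w′ q
    splitting-unique S S′ α≗α′ β≗β′ q<N with position q<N
    ... | before p<i = trans (left S p<i) (trans (cong (_+ j) (α≗α′ p<i)) (sym (left S′ p<i)))
    ... | at-top     = trans (top S) (sym (top S′))
    ... | after p<j  = trans (right S p<j) (trans (β≗β′ p<j) (sym (right S′ p<j)))

  clamp : ∀ {n} → ℕ → Fin (suc n)
  clamp {n} x = fromℕ< (s≤s (m⊓n≤n x n))

  toℕ-clamp : ∀ {n x} → x ≤ n → toℕ (clamp {n} x) ≡ x
  toℕ-clamp x≤n = trans (toℕ-fromℕ< _) (m≤n⇒m⊓n≡m x≤n)

  -- Positions and values of a word as natural numbers; outside the word the values are junk.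
  toFun : ∀ {n} → Word n → ℕ → ℕ
  toFun {zero}  π p = 0
  toFun {suc n} π p = toℕ (lookup π (clamp p))

  fromFun : (n : ℕ) → (ℕ → ℕ) → Word n
  fromFun zero    w = []
  fromFun (suc n) w = tabulate (clamp ∘ w ∘ toℕ)

  toFun-toℕ : ∀ {n} (π : Word n) a → toFun π (toℕ a) ≡ toℕ (lookup π a)
  toFun-toℕ {suc n} π a = cong (toℕ ∘ lookup π) (toℕ-injective (toℕ-clamp (≤-pred (toℕ<n a))))

  toFun-fromℕ< : ∀ {n p} (π : Word n) (p<n : p < n) → toFun π p ≡ toℕ (lookup π (fromℕ< p<n))
  toFun-fromℕ< π p<n = trans (cong (toFun π) (sym (toℕ-fromℕ< p<n))) (toFun-toℕ π _)

  toFun-bounded : ∀ {n p} (π : Word n) → p < n → toFun π p < n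
  toFun-bounded π p<n = subst (_< _) (sym (toFun-fromℕ< π p<n)) (toℕ<n _)

  toFun-fromFun : ∀ n {w} → (∀ {p} → p < n → w p < n) → ∀ {p} → p < n → toFun (fromFun n w) p ≡ w p
  toFun-fromFun (suc n) {w} w<n {p} p<n = begin
    toℕ (lookup (tabulate (clamp ∘ w ∘ toℕ)) (clamp p))
      ≡⟨ cong toℕ (lookup∘tabulate (clamp ∘ w ∘ toℕ) (clamp p)) ⟩
    toℕ (clamp (w (toℕ (clamp {n} p))))
      ≡⟨ cong (toℕ ∘ clamp ∘ w) (toℕ-clamp (≤-pred p<n)) ⟩
    toℕ (clamp {n} (w p))
      ≡⟨ toℕ-clamp (≤-pred (w<n p<n)) ⟩
    w p
      ∎
    where open ≡-Reasoning

  fromFun-cong : ∀ n {w w′} → (∀ {p} → p < n → w p ≡ w′ p) → fromFun n w ≡ fromFun n w′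
  fromFun-cong zero    w≗w′ = refl
  fromFun-cong (suc n) w≗w′ = tabulate-cong (λ a → cong clamp (w≗w′ (toℕ<n a)))

  fromFun-toFun : ∀ {n} (π : Word n) → fromFun n (toFun π) ≡ π
  fromFun-toFun {zero}  []  = refl
  fromFun-toFun {suc n} π = trans (tabulate-cong clamp-lookup) (tabulate∘lookup π)
    where
    clamp-lookup : ∀ a → clamp (toFun π (toℕ a)) ≡ lookup π a
    clamp-lookup a = toℕ-injective (trans (toℕ-clamp (≤-pred (toFun-bounded π (toℕ<n a)))) (toFun-toℕ π a))

  contains⇒occurs : ∀ {n τ} (π : Word n) → Contains π τ → Occurs n (toFun π) τ
  contains⇒occurs π (ι , increasing , order-iso , adjacent) = toℕ ∘ ι , record
    { in-range   = toℕ<n ∘ ι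
    ; increasing = increasing
    ; order-iso  = λ a b → subst (_ ⇔_) (sym (cong₂ _<_ (toFun-toℕ π (ι a)) (toFun-toℕ π (ι b))))
                                 (order-iso a b)
    ; adjacent   = adjacent
    }

  occurs⇒contains : ∀ {n τ} (π : Word n) → Occurs n (toFun π) τ → Contains π τ
  occurs⇒contains π (ι , o) =
    ι′ ,
    (λ a b a<b → subst₂ _<_ (sym (toℕ-ι′ a)) (sym (toℕ-ι′ b)) (increasing o a b a<b)) ,
    (λ a b → subst (_ ⇔_) (cong₂ _<_ (toFun-fromℕ< π (in-range o a)) (toFun-fromℕ< π (in-range o b)))
                         (order-iso o a b)) ,
    (λ a b b≡a+1 d → trans (toℕ-ι′ b) (trans (adjacent o a b b≡a+1 d) (cong suc (sym (toℕ-ι′ a)))))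
    where
    ι′ = λ a → fromℕ< (in-range o a)
    toℕ-ι′ : ∀ a → toℕ (ι′ a) ≡ ι a
    toℕ-ι′ a = toℕ-fromℕ< (in-range o a)

  Av : ∀ {n} → GPattern → Word n → Set
  Av τ π = IsPerm π × Avoids π p1-3-2 × Avoids π τ

  isPerm⇒injective : ∀ {n} (π : Word n) → IsPerm π →
                     ∀ {p q} → p < n → q < n → toFun π p ≡ toFun π q → p ≡ q
  isPerm⇒injective π π-perm {p} {q} p<n q<n eq = begin
    p                 ≡⟨ toℕ-fromℕ< p<n ⟨
    toℕ (fromℕ< p<n)  ≡⟨ cong toℕ (π-perm _ _ (toℕ-injective lookups≡)) ⟩
    toℕ (fromℕ< q<n)  ≡⟨ toℕ-fromℕ< q<n ⟩
    q                 ∎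
    where
    open ≡-Reasoning
    lookups≡ : toℕ (lookup π (fromℕ< p<n)) ≡ toℕ (lookup π (fromℕ< q<n))
    lookups≡ = trans (sym (toFun-fromℕ< π p<n)) (trans eq (toFun-fromℕ< π q<n))

  injective⇒isPerm : ∀ {n} (π : Word n) →
                     (∀ {p q} → p < n → q < n → toFun π p ≡ toFun π q → p ≡ q) → IsPerm π
  injective⇒isPerm π injective a b eq = toℕ-injective (injective (toℕ<n a) (toℕ<n b)
    (trans (toFun-toℕ π a) (trans (cong toℕ eq) (sym (toFun-toℕ π b)))))

  Av⇒avoider : ∀ {n τ} (π : Word n) → Av τ π → Avoider τ n (toFun π)
  Av⇒avoider π (π-perm , π-132 , π-τ) = record
    { bounded    = toFun-bounded π
    ; injective  = isPerm⇒injective π π-perm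
    ; avoids-132 = π-132 ∘ occurs⇒contains π
    ; avoids-τ   = π-τ ∘ occurs⇒contains π
    }

  avoider⇒Av : ∀ {n τ} (π : Word n) → Avoider τ n (toFun π) → Av τ π
  avoider⇒Av π A =
    injective⇒isPerm π (injective A) , avoids-132 A ∘ contains⇒occurs π , avoids-τ A ∘ contains⇒occurs π

  Av-fromFun : ∀ {n τ w} → Avoider τ n w → Av τ (fromFun n w)
  Av-fromFun {n} A = avoider⇒Av _ (avoider-cong (sym ∘ toFun-fromFun n (bounded A)) A)

  -- Monotone words

  ascending-gap : ∀ {n} {w : ℕ → ℕ} → (∀ {p} → suc p < n → w p < w (suc p)) →
                  ∀ d {p} → d + p < n → d + w p ≤ w (d + p)
  ascending-gap ascent zero    _         = ≤-refl
  ascending-gap ascent (suc d) d+p+1<n = ≤-<-trans (ascending-gap ascent d (<-trans (n<1+n _) d+p+1<n)) (ascent d+p+1<n)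

  descending-gap : ∀ {n} {w : ℕ → ℕ} → (∀ {p} → suc p < n → w (suc p) < w p) →
                   ∀ d {p} → d + p < n → d + w (d + p) ≤ w p
  descending-gap descent zero    _         = ≤-refl
  descending-gap descent (suc d) d+p+1<n =
    <-≤-trans (+-monoʳ-< d (descent d+p+1<n)) (descending-gap descent d (<-trans (n<1+n _) d+p+1<n))

  module _ {n : ℕ} {w : ℕ → ℕ} (w<n : ∀ {p} → p < n → w p < n) {p : ℕ} (p<n : p < n) where

    rest+p<n : (n ∸ suc p) + p < n
    rest+p<n = subst ((n ∸ suc p) + p <_) (m∸n+n≡m p<n) (+-monoʳ-< (n ∸ suc p) (n<1+n p))

    p+0<n : p + 0 < n
    p+0<n = subst (_< n) (sym (+-identityʳ p)) p<n

    ascending⇒identity : (∀ {q} → suc q < n → w q < w (suc q)) → w p ≡ p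
    ascending⇒identity ascent = ≤-antisym (≤-pred upper) lower
      where
      lower : p ≤ w p
      lower = ≤-trans (m≤m+n p (w 0)) (subst (p + w 0 ≤_) (cong w (+-identityʳ p)) (ascending-gap ascent p p+0<n))
      upper : w p < suc p
      upper = +-cancelˡ-< (n ∸ suc p) _ _ (subst ((n ∸ suc p) + w p <_) (sym (m∸n+n≡m p<n))
                (≤-<-trans (ascending-gap ascent (n ∸ suc p) rest+p<n) (w<n rest+p<n)))

    descending⇒reversal : (∀ {q} → suc q < n → w (suc q) < w q) → w p ≡ n ∸ suc p
    descending⇒reversal descent = ≤-antisym upper lower
      where
      p+wp<n : p + w p < n
      p+wp<n = ≤-<-trans (subst (λ x → p + w x ≤ w 0) (+-identityʳ p) (descending-gap descent p p+0<n))
                         (w<n (≤-<-trans z≤n p<n))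
      upper : w p ≤ n ∸ suc p
      upper = m+n≤o⇒m≤o∸n (w p) (subst (_≤ n) (trans (cong suc (+-comm p (w p))) (sym (+-suc (w p) p))) p+wp<n)
      lower : n ∸ suc p ≤ w p
      lower = ≤-trans (m≤m+n (n ∸ suc p) _) (descending-gap descent (n ∸ suc p) rest+p<n)

  reversal : ℕ → ℕ → ℕ
  reversal n p = n ∸ suc p

  ascending-avoids : ∀ {n w τ} → (∀ {p q} → p < q → q < n → w p < w q) →
                     ∀ a b → a <ᶠ b → letter τ b < letter τ a → ¬ Occurs n w τ
  ascending-avoids ascending a b a<b descent (ι , o) =
    <-asym (to (order-iso o b a) descent) (ascending (increasing o a b a<b) (in-range o b))

  descending-avoids : ∀ {n w τ} → (∀ {p q} → p < q → q < n → w q < w p) →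
                      ∀ a b → a <ᶠ b → letter τ a < letter τ b → ¬ Occurs n w τ
  descending-avoids descending a b a<b ascent (ι , o) =
    <-asym (to (order-iso o a b) ascent) (descending (increasing o a b a<b) (in-range o b))

  identity-avoider : ∀ {t} n → second t < first t → Avoider (extPattern t 0) n id
  identity-avoider n descent = record
    { bounded    = id
    ; injective  = λ _ _ → id
    ; avoids-132 = ascending-avoids (λ p<q _ → p<q) 1F 2F (s≤s (s≤s z≤n))
                     (s≤s (s≤s (s≤s z≤n)))
    ; avoids-τ   = ascending-avoids (λ p<q _ → p<q) 0F 1F (s≤s z≤n) descent
    }

  reversal-avoider : ∀ {t} n → first t < second t → Avoider (extPattern t 0) n (reversal n)
  reversal-avoider n ascent = record
    { bounded    = ∸-monoʳ-< z<s
    ; injective  = λ p<n q<n eq → suc-injective (∸-cancelˡ-≡ p<n q<n eq)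
    ; avoids-132 = descending-avoids reversal-descending 0F 1F (s≤s z≤n) (s≤s (s≤s z≤n))
    ; avoids-τ   = descending-avoids reversal-descending 0F 1F (s≤s z≤n) ascent
    }
    where
    reversal-descending : ∀ {p q} → p < q → q < n → reversal n q < reversal n p
    reversal-descending p<q q<n = ∸-monoʳ-< (s≤s p<q) q<n

  module _ {t : Tau} {n : ℕ} {w : ℕ → ℕ} (A : Avoider (extPattern t 0) n w) where

    avoider-descending : first t < second t → ∀ {p} → suc p < n → w (suc p) < w p
    avoider-descending ascent {p} p+1<n with <-cmp (w p) (w (suc p))
    ... | tri< wp<wp+1 _ _ = contradiction
          (adjacent-occurrence t p+1<n (both ascent wp<wp+1) (neither (<-asym ascent) (<-asym wp<wp+1))) (avoids-τ A)
    ... | tri≈ _ wp≡wp+1 _ = contradiction (injective A (<-trans (n<1+n p) p+1<n) p+1<n wp≡wp+1) (<⇒≢ (n<1+n p))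
    ... | tri> _ _ wp+1<wp = wp+1<wp

    avoider-ascending : second t < first t → ∀ {p} → suc p < n → w p < w (suc p)
    avoider-ascending descent {p} p+1<n with <-cmp (w p) (w (suc p))
    ... | tri< wp<wp+1 _ _ = wp<wp+1
    ... | tri≈ _ wp≡wp+1 _ = contradiction (injective A (<-trans (n<1+n p) p+1<n) p+1<n wp≡wp+1) (<⇒≢ (n<1+n p))
    ... | tri> _ _ wp+1<wp = contradiction
          (adjacent-occurrence t p+1<n (neither (<-asym descent) (<-asym wp+1<wp)) (both descent wp+1<wp)) (avoids-τ A)

  ascending-or-descending : ∀ t → first t < second t ⊎ second t < first t
  ascending-or-descending t12  = inj₁ (s≤s (s≤s z≤n))
  ascending-or-descending t1-2 = inj₁ (s≤s (s≤s z≤n))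
  ascending-or-descending t21  = inj₂ (s≤s (s≤s z≤n))
  ascending-or-descending t2-1 = inj₂ (s≤s (s≤s z≤n))

  ≡fromFun : ∀ {n w} (π : Word n) → (∀ {p} → p < n → toFun π p ≡ w p) → π ≡ fromFun n w
  ≡fromFun {n} π π≗w = trans (sym (fromFun-toFun π)) (fromFun-cong n π≗w)

  count-base : ∀ t n → CountIs (extPattern t 0) n 1
  count-base t n with ascending-or-descending t
  ... | inj₁ ascent  = card-singleton (fromFun n (reversal n)) (Av-fromFun (reversal-avoider n ascent))
    (λ π Avπ → ≡fromFun π (λ p<n → descending⇒reversal (toFun-bounded π) p<n
                                     (avoider-descending (Av⇒avoider π Avπ) ascent)))
  ... | inj₂ descent = card-singleton (fromFun n id) (Av-fromFun (identity-avoider n descent))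
    (λ π Avπ → ≡fromFun π (λ p<n → ascending⇒identity (toFun-bounded π) p<n
                                     (avoider-ascending (Av⇒avoider π Avπ) descent)))

  count-empty : ∀ τ → Fin (len τ) → CountIs τ 0 1
  count-empty τ a = card-singleton [] ((λ ()) , (λ (ι , _) → ¬Fin0 (ι 0F)) , (λ (ι , _) → ¬Fin0 (ι a)))
                                   (λ { [] _ → refl })

  module Recurrence (t : Tau) (m n : ℕ) where

    TopAt : ℕ → Word (suc n) → Set
    TopAt i π = Av (extPattern t (suc m)) π × toFun π i ≡ n

    top-exists : (π : Word (suc n)) → IsPerm π → ∃[ i ] i ≤ n × toFun π i ≡ n
    top-exists π π-perm with injective⇒existsPivot {f = lookup π} (λ {a} {b} → π-perm a b) (fromℕ n)
    ... | a , _ , n≤πa = toℕ a , ≤-pred (toℕ<n a) ,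
      trans (toFun-toℕ π a) (≤-antisym (≤-pred (toℕ<n _)) (subst (_≤ toℕ (lookup π a)) (toℕ-fromℕ n) n≤πa))

    top-unique : ∀ {i k π} → i ≤ n → k ≤ n → TopAt i π → TopAt k π → i ≡ k
    top-unique {π = π} i≤n k≤n (Avπ , πi≡n) (_ , πk≡n) =
      injective (Av⇒avoider π Avπ) (s≤s i≤n) (s≤s k≤n) (trans πi≡n (sym πk≡n))

    card-TopAt : ∀ {i a b} → i ≤ n → CountIs (extPattern t m) i a → CountIs (extPattern t (suc m)) (n ∸ i) b →
                 Card (TopAt i) (a * b)
    card-TopAt {i} i≤n count-α count-β =
      card-bijection join split join-TopAt split-Parts split∘join join∘split (card-× count-α count-β)
      where
      j = n ∸ i
      open Decomposition t m {i} {j} {n} (m+[n∸m]≡n i≤n)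

      join : Word i × Word j → Word (suc n)
      join (α , β) = fromFun (suc n) (glue i j n (toFun α) (toFun β))

      split : Word (suc n) → Word i × Word j
      split π = fromFun i (λ p → toFun π p ∸ j) , fromFun j (λ p → toFun π (suc (i + p)))

      Parts : Word i × Word j → Set
      Parts (α , β) = Av (extPattern t m) α × Av (extPattern t (suc m)) β

      module _ {α : Word i} {β : Word j} (Avα : Av (extPattern t m) α) (Avβ : Av (extPattern t (suc m)) β) where
        glued : Avoider (extPattern t (suc m)) (suc n) (glue i j n (toFun α) (toFun β))
        glued = Compose.avoider (glue-splitting _ _) (Av⇒avoider α Avα) (Av⇒avoider β Avβ)
        toFun-join : ∀ {p} → p < suc n → toFun (join (α , β)) p ≡ glue i j n (toFun α) (toFun β) p
        toFun-join = toFun-fromFun (suc n) (bounded glued)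

      join-TopAt : ∀ αβ → Parts αβ → TopAt i (join αβ)
      join-TopAt _ (Avα , Avβ) = Av-fromFun (glued Avα Avβ) , trans (toFun-join Avα Avβ i<N) (glue-top i)

      split-Parts : ∀ π → TopAt i π → Parts (split π)
      split-Parts π (Avπ , πi≡n) = Av-fromFun left-avoider , Av-fromFun right-avoider
        where open Decompose (Av⇒avoider π Avπ) πi≡n

      split∘join : ∀ αβ → Parts αβ → split (join αβ) ≡ αβ
      split∘join (α , β) (Avα , Avβ) = cong₂ _,_ (sym (≡fromFun α left≡)) (sym (≡fromFun β right≡))
        where
        left≡ : ∀ {p} → p < i → toFun α p ≡ toFun (join (α , β)) p ∸ j
        left≡ {p} p<i = sym (trans (cong (_∸ j) (trans (toFun-join Avα Avβ (before<N p<i)) (glue-left i p<i)))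
                                   (m+n∸n≡m (toFun α p) j))
        right≡ : ∀ {p} → p < j → toFun β p ≡ toFun (join (α , β)) (suc (i + p))
        right≡ {p} p<j = sym (trans (toFun-join Avα Avβ (after<N p<j)) (glue-right i p))

      join∘split : ∀ π → TopAt i π → join (split π) ≡ π
      join∘split π (Avπ , πi≡n) = sym (≡fromFun π (λ q<N → sym (splitting-unique (glue-splitting _ _) splitting
        (toFun-fromFun i (bounded left-avoider)) (toFun-fromFun j (bounded right-avoider)) q<N)))
        where open Decompose (Av⇒avoider π Avπ) πi≡n

    count-step : ∀ {a b : ℕ → ℕ} → (∀ i → i ≤ n → CountIs (extPattern t m) i (a i)) →
                 (∀ i → i ≤ n → CountIs (extPattern t (suc m)) i (b i)) →
                 CountIs (extPattern t (suc m)) (suc n) (∑≤ n (λ i → a i * b (n ∸ i)))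
    count-step {a} {b} count-α count-β = card-resp (λ π → mk⇔ (λ (_ , _ , Avπ , _) → Avπ) (has-top π))
      (card-⋃≤ {Q = TopAt} {λ i → a i * b (n ∸ i)} n (λ {i} {k} {π} → top-unique {i} {k} {π})
         (λ i i≤n → card-TopAt i≤n (count-α i i≤n) (count-β (n ∸ i) (m∸n≤m n i))))
      where
      has-top : ∀ π → Av (extPattern t (suc m)) π → ∃[ i ] i ≤ n × TopAt i π
      has-top π Avπ with top-exists π (proj₁ Avπ)
      ... | i , i≤n , πi≡n = i , i≤n , Avπ , πi≡n

  choose-below : ∀ {P : ℕ → ℕ → Set} n → (∀ i → i ≤ n → ∃ (P i)) → ∃[ c ] (∀ i → i ≤ n → P i (c i))
  choose-below {P} n choice =
    c , λ i i≤n → subst (λ k → P k (c i)) (m≤n⇒m⊓n≡m i≤n) (proj₂ (choice (i ⊓ n) (m⊓n≤n i n)))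
    where
    c : ℕ → ℕ
    c i = proj₁ (choice (i ⊓ n) (m⊓n≤n i n))

  count-exists : ∀ t m n → ∃ (CountIs (extPattern t m) n)
  count-exists t zero    n = 1 , count-base t n
  count-exists t (suc m)   = <-rec _ step
    where
    step : ∀ n → (∀ {i} → i < n → ∃ (CountIs (extPattern t (suc m)) i)) → ∃ (CountIs (extPattern t (suc m)) n)
    step zero    _       = 1 , count-empty _ 0F
    step (suc n) smaller with choose-below n (λ i i≤n → smaller (s≤s i≤n))
    ... | b , count-β = _ , Recurrence.count-step t m n {λ i → proj₁ (count-exists t m i)} {b}
                              (λ i _ → proj₂ (count-exists t m i)) count-β

  count : Tau → ℕ → ℕ → ℕ
  count t m n = proj₁ (count-exists t m n)

  count-spec : ∀ t m n → CountIs (extPattern t m) n (count t m n)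
  count-spec t m n = proj₂ (count-exists t m n)

  count-zero : ∀ t m → count t (suc m) 0 ≡ 1
  count-zero t m = card-unique (count-spec t (suc m) 0) (count-empty _ 0F)

  count-recurrence : ∀ t m n → count t (suc m) (suc n) ≡ ∑≤ n (λ i → count t m i * count t (suc m) (n ∸ i))
  count-recurrence t m n =
    card-unique (count-spec t (suc m) (suc n))
                (Recurrence.count-step t m n (λ i _ → count-spec t m i) (λ i _ → count-spec t (suc m) i))

open import Data.Nat.Base as ℕ using (zero; _∸_)
open import Data.Integer.Base using (+_; _+_)
import Data.Integer.Properties as ℤ
open import Function.Base using (_∘_)
open import Relation.Binary.PropositionalEquality using (refl; sym; trans; cong; _≗_; module ≡-Reasoning)
open PowerSeries
open Cardinality using (∑≤; card-unique)
open Avoidance using (count; count-spec; count-zero; count-recurrence)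

+∑≤ : ∀ n c → + ∑≤ n c ≡ sumUpTo n (+_ ∘ c)
+∑≤ zero    c = refl
+∑≤ (suc n) c = trans (ℤ.pos-+ (c 0) _) (cong (_+_ (+ c 0)) (+∑≤ n (c ∘ suc)))

-- R t m is F_{m+1}, the generating function for k = m + 1, and R t 0 = F_1 = 1.
R : Tau → ℕ → Series
R t zero    = 𝟙
R t (suc m) = +_ ∘ count t m

R-fixpoint : ∀ t m → R t (suc m) ≗ 𝟙 ⊕ x· (R t m ⊛ R t (suc m))
R-fixpoint t zero    zero    = refl
R-fixpoint t zero    (suc n) = sym (trans (ℤ.+-identityˡ _) (𝟙-⊛ (R t 1) n))
R-fixpoint t (suc m) zero    = cong +_ (count-zero t m)
R-fixpoint t (suc m) (suc n) = begin
  + count t (suc m) (suc n)                                         ≡⟨ cong +_ (count-recurrence t m n) ⟩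
  + ∑≤ n (λ i → count t m i ℕ.* count t (suc m) (n ∸ i))            ≡⟨ +∑≤ n _ ⟩
  sumUpTo n (λ i → + (count t m i ℕ.* count t (suc m) (n ∸ i)))     ≡⟨ sumUpTo-cong n (λ i → ℤ.pos-* (count t m i) _) ⟩
  (R t (suc m) ⊛ R t (suc (suc m))) n                               ≡⟨ ℤ.+-identityˡ _ ⟨
  (𝟙 ⊕ x· (R t (suc m) ⊛ R t (suc (suc m)))) (suc n)                ∎
  where open ≡-Reasoning

theorem2p3 : (t : Tau) (m : ℕ) (f : ℕ → ℕ) →
    (∀ n → CountIs (extPattern t m) n (f n)) →
    ∀ n → convV f (suc (suc m)) n ≡ V (suc m) n
theorem2p3 t m f f-counts n = begin
  convV f (suc (suc m)) n           ≡⟨ convV≡V⊛ f (suc (suc m)) n ⟩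
  (V (suc (suc m)) ⊛ (+_ ∘ f)) n    ≡⟨ ⊛-congʳ (V (suc (suc m))) (cong +_ ∘ f≡count) n ⟩
  (V (suc (suc m)) ⊛ R t (suc m)) n ≡⟨ V-ratio (R t) (λ _ → refl) (R-fixpoint t) (suc m) n ⟩
  V (suc m) n                       ∎
  where
  open ≡-Reasoning
  f≡count : ∀ k → f k ≡ count t m k
  f≡count k = card-unique (f-counts k) (count-spec t m k)
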